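{- Let $\mathbf H$ be a commutative and cocommutative connected Hopf monoid linearized in the basis $\mathbf h$, $I$ a finite set, $x,y\in\mathbf h[I]$ with $\mathcal C_x^y\neq\emptyset$, and let $\Lambda=(\Lambda_1,\dots,\Lambda_m)$ be a minimal element of $\mathcal C_x^y$. For $\sigma\in S_m$ write $\sigma\Lambda=(\Lambda_{\sigma(1)},\dots,\Lambda_{\sigma(m)})$. Then every minimal element of $\big(\bigcup_{\sigma\in S_m}[\sigma\Lambda,(I)]\big)\setminus\mathcal C_x^y$ is a set composition obtained by permuting the parts of a set composition of the form $$\Big(\bigcup_{i\in U}\Lambda_i,\Lambda_{v_1},\Lambda_{v_2},\dots,\Lambda_{v_r}\Big)$$ for some $U\subseteq\{1,\dots,m\}$, where $r=m-|U|$ and $\{v_1,\dots,v_r\}=\{1,\dots,m\}\setminus U$.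
   Context: Work over a field of characteristic $0$. A connected Hopf monoid in vector species $\mathbf H$ has products $\mu_{A_1,A_2}$ and coproducts $\Delta_{A_1,A_2}$ for ordered decompositions $I=A_1\sqcup A_2$, satisfying associativity, coassociativity and compatibility axioms; commutative and cocommutative mean $\mu$ and $\Delta$ are invariant under swapping the two factors. It is linearized in the basis $\mathbf h$ if products send basis pairs to basis elements and coproducts send basis elements to $0$ or to a tensor of basis elements. A set composition $A=(A_1,\dots,A_k)\models I$ is a sequence of nonempty disjoint subsets with union $I$; $(I)$ is the one-part composition; $\mu_A,\Delta_A$ are iterated product/coproduct. $A\le B$ if every part of $B$ is a union of consecutive parts of $A$, and $[C,(I)]=\{B\models I: C\le B\}$. For $x\in\mathbf h[I]$ with $\Delta_A(x)\ne0$ put $x_A=\mu_A\Delta_A(x)$, and $\mathcal C_x^y=\{A\models I:\Delta_A(x)\ne0,\ x_A=y\}$. -}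

module Defs where

open import Data.Nat using (ℕ)
open import Data.Fin.Subset using (Subset; ⊥; _∪_; _∩_; ⋃; Nonempty)
open import Data.List using (List; []; _∷_; _++_)
open import Data.List.Relation.Unary.All using (All; []; _∷_)
open import Data.List.Relation.Binary.Permutation.Propositional using (_↭_)
open import Data.Maybe using (Maybe; just; nothing; _>>=_)
import Data.Maybe as M
open import Data.Product using (Σ; _×_; _,_; ∃; ∃-syntax)
open import Relation.Binary.PropositionalEquality using (_≡_)

Decomp : ∀ {n} → Subset n → Subset n → Subset n → Set
Decomp S A B = (A ∪ B ≡ S) × (A ∩ B ≡ ⊥)

-- A commutative, cocommutative, connected Hopf monoid in vector species,
-- linearized in the basis h, described through its basis (restricted to
-- the subsets of a finite ground set Fin n):
--   h S      : the basis of H[S],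
--   μ d a b  : the product μ_{A,B}(a ⊗ b) (a basis element),
--   Δ d x    : the coproduct Δ_{A,B}(x), either 0 (nothing) or a ⊗ b (just (a , b)).
record LinHopf (n : ℕ) : Set₁ where
  field
    h : Subset n → Set
    μ : ∀ {S A B} → Decomp S A B → h A → h B → h S
    Δ : ∀ {S A B} → Decomp S A B → h S → Maybe (h A × h B)
    -- connectedness: H[∅] is one-dimensional, spanned by the unit
    unit : h ⊥
    unit-unique : ∀ (z : h ⊥) → z ≡ unit
    unitˡ : ∀ {S} (d : Decomp S ⊥ S) (x : h S) → μ d unit x ≡ x
    unitʳ : ∀ {S} (d : Decomp S S ⊥) (x : h S) → μ d x unit ≡ x
    counitˡ : ∀ {S} (d : Decomp S ⊥ S) (x : h S) → Δ d x ≡ just (unit , x)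
    counitʳ : ∀ {S} (d : Decomp S S ⊥) (x : h S) → Δ d x ≡ just (x , unit)
    assoc : ∀ {S A B C D E}
      (d₁ : Decomp D A B) (d₂ : Decomp S D C)
      (e₁ : Decomp E B C) (e₂ : Decomp S A E)
      (a : h A) (b : h B) (c : h C) →
      μ d₂ (μ d₁ a b) c ≡ μ e₂ a (μ e₁ b c)
    coassoc : ∀ {S A B C D E}
      (d₁ : Decomp D A B) (d₂ : Decomp S D C)
      (e₁ : Decomp E B C) (e₂ : Decomp S A E)
      (x : h S) →
      (Δ d₂ x >>= λ { (u , c) → M.map (λ { (a , b) → (a , b , c) }) (Δ d₁ u) })
        ≡ (Δ e₂ x >>= λ { (a , v) → M.map (λ { (b , c) → (a , b , c) }) (Δ e₁ v) })
    -- compatibility: S = A ⊔ B = C ⊔ D, with P = A ∩ C, Q = A ∩ D,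
    -- R = B ∩ C, T = B ∩ D (these are forced by the four decompositions)
    compat : ∀ {S A B C D P Q R T}
      (dAB : Decomp S A B) (dCD : Decomp S C D)
      (dA : Decomp A P Q) (dB : Decomp B R T)
      (dC : Decomp C P R) (dD : Decomp D Q T)
      (a : h A) (b : h B) →
      Δ dCD (μ dAB a b)
        ≡ (Δ dA a >>= λ { (p , q) → Δ dB b >>= λ { (r , t) →
             just (μ dC p r , μ dD q t) } })
    comm : ∀ {S A B} (d : Decomp S A B) (d' : Decomp S B A)
      (a : h A) (b : h B) → μ d a b ≡ μ d' b a
    cocomm : ∀ {S A B} (d : Decomp S A B) (d' : Decomp S B A) (x : h S) →
      Δ d' x ≡ M.map (λ { (a , b) → (b , a) }) (Δ d x)

data Comp {n : ℕ} : Subset n → List (Subset n) → Set where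
  nil  : Comp ⊥ []
  cons : ∀ {S A L} → Nonempty A → Decomp S A (⋃ L) → Comp (⋃ L) L →
         Comp S (A ∷ L)

module _ {n : ℕ} (H : LinHopf n) where
  open LinHopf H

  Δs : ∀ {S L} → Comp S L → h S → Maybe (All h L)
  Δs nil x = just []
  Δs (cons _ d c) x =
    Δ d x >>= λ { (a , r) → M.map (a ∷_) (Δs c r) }

  μs : ∀ {S L} → Comp S L → All h L → h S
  μs nil [] = unit
  μs (cons _ d c) (a ∷ as) = μ d a (μs c as)

  InC : ∀ {I} → h I → h I → List (Subset n) → Set
  InC {I} x y A = Σ (Comp I A) λ c → Σ (All h A) λ v →
    (Δs c x ≡ just v) × (μs c v ≡ y)

data _≼_ {n : ℕ} : List (Subset n) → List (Subset n) → Set where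
  []   : [] ≼ []
  step : ∀ {B Bs} (P Q : List (Subset n)) → ⋃ P ≡ B → Q ≼ Bs →
         (P ++ Q) ≼ (B ∷ Bs)

Minimal : ∀ {n} → (List (Subset n) → Set) → List (Subset n) → Set
Minimal X A = X A × (∀ A' → X A' → A' ≼ A → A' ≡ A)

InUpsetMinusC : ∀ {n} (H : LinHopf n) {I : Subset n} →
  LinHopf.h H I → LinHopf.h H I → List (Subset n) → List (Subset n) → Set
InUpsetMinusC H {I} x y Λ B =
  Comp I B × (∃[ σΛ ] (σΛ ↭ Λ × σΛ ≼ B)) × (InC H x y B → Data.Empty.⊥)
  where import Data.Empty

-- Every part of B is the union of a block of consecutive parts of some σΛ ≤ B. If two
-- blocks merged at least two parts each, splitting either of them would give a strictly
-- finer composition still above σΛ, which by minimality of B lies in 𝒞_x^y. By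
-- coassociativity, x at such a splitting is μ_B applied to Δ_B(x) with one tensor factor
-- replaced; since Δ_B ∘ μ_B is the identity on basis elements, two such splittings at
-- different parts both giving y force x_B = y, contradicting B ∉ 𝒞_x^y. Hence at most one
-- block merges several parts, which is the claimed shape.
module Submission where

open import Defs
open import Axiom.UniquenessOfIdentityProofs.WithK using (uip)
open import Data.Empty using (⊥-elim)
open import Data.Fin.Subset using (Subset; ⋃; _∪_; _∩_; _⊆_; Nonempty; ⊥)
  renaming (_∈_ to _∈ₛ_)
open import Data.Fin.Subset.Properties
  using (∪-assoc; ∪-comm; ∪-identityˡ; ∪-identityʳ; ∩-comm; ∩-distribˡ-∪; ∩-zeroˡ; ∩-zeroʳ;
         ⊆-antisym; ⊥⊆; p⊆p∪q; q⊆p∪q; x∈p∩q⁺; x∈p∩q⁻; ∉⊥)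
open import Data.List using (List; []; _∷_; _++_; length)
open import Data.List.Properties using (length-++; ∷-injectiveʳ)
open import Data.List.Membership.Propositional using (_∈_; _≢∈_)
open import Data.List.Relation.Binary.Permutation.Propositional
  using (_↭_; refl; prep; swap; trans; ↭-sym; ↭-trans)
open import Data.List.Relation.Binary.Permutation.Propositional.Properties
  using (↭-empty-inv; shift; shifts)
open import Data.List.Relation.Unary.All using (All; []; _∷_; lookup; _[_]≔_)
open import Data.List.Relation.Unary.All.Properties
  using (++⁺; lookup∘updateAt; lookup∘updateAt′; updateAt-id-local)
open import Data.List.Relation.Unary.Any using (here; there)
open import Data.List.Relation.Unary.Any.Properties using (there-injective)
open import Data.Maybe using (Maybe; just; nothing; _>>=_)
import Data.Maybe as Maybe
open import Data.Maybe.Properties using (just-injective)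
open import Data.Nat using (ℕ; _≤_; s≤s; z≤n)
open import Data.Nat.Properties using (+-cancelʳ-≡; <-irrefl)
open import Data.Product using (Σ-syntax; ∃-syntax; ∃₂; _×_; _,_; proj₁; proj₂)
open import Relation.Binary.PropositionalEquality as ≡
  using (_≡_; _≢_; cong; cong₂; subst; sym)
open import Relation.Nullary using (¬_)

module _ {a} {X : Set a} where

  replaceAt : ∀ {x : X} {xs} → x ∈ xs → List X → List X
  replaceAt {xs = _ ∷ xs} (here _)  ys = ys ++ xs
  replaceAt {xs = x ∷ _}  (there i) ys = x ∷ replaceAt i ys

  replaceAt-≡⇒length≡1 : ∀ {x : X} {xs} (i : x ∈ xs) {ys} → replaceAt i ys ≡ xs → length ys ≡ 1
  replaceAt-≡⇒length≡1 {xs = _ ∷ xs} (here _) {ys} eq =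
    +-cancelʳ-≡ (length xs) (length ys) 1 (≡.trans (sym (length-++ ys)) (cong length eq))
  replaceAt-≡⇒length≡1 (there i) eq = replaceAt-≡⇒length≡1 i (∷-injectiveʳ eq)

  replaceAt⁺ : ∀ {p} {P : X → Set p} {x : X} {xs ys} (i : x ∈ xs) → All P xs → All P ys →
    All P (replaceAt i ys)
  replaceAt⁺ (here _)  (_ ∷ pxs)  pys = ++⁺ pys pxs
  replaceAt⁺ (there i) (px ∷ pxs) pys = px ∷ replaceAt⁺ i pxs pys

  there-≢∈ : ∀ {x y z : X} {xs} {i : x ∈ xs} {j : y ∈ xs} → i ≢∈ j → there {x = z} i ≢∈ there j
  there-≢∈ i≢j ≡.refl eq = i≢j ≡.refl (there-injective eq)

module _ {X Y : Set} where

  >>=-just⁻ : ∀ (m : Maybe X) (k : X → Maybe Y) {y} → (m >>= k) ≡ just y →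
    ∃[ x ] m ≡ just x × k x ≡ just y
  >>=-just⁻ (just x) k eq = x , ≡.refl , eq

  map-just⁻ : ∀ (f : X → Y) (m : Maybe X) {y} → Maybe.map f m ≡ just y →
    ∃[ x ] m ≡ just x × f x ≡ y
  map-just⁻ f (just x) eq = x , ≡.refl , just-injective eq

module _ {n : ℕ} where

  disjoint-⊆ˡ : ∀ {A A' B : Subset n} → A' ⊆ A → A ∩ B ≡ ⊥ → A' ∩ B ≡ ⊥
  disjoint-⊆ˡ {A} {A'} {B} A'⊆A A∩B≡⊥ = ⊆-antisym A'∩B⊆⊥ ⊥⊆
    where
    A'∩B⊆⊥ : A' ∩ B ⊆ ⊥
    A'∩B⊆⊥ x∈ with x∈p∩q⁻ A' B x∈
    ... | x∈A' , x∈B = subst (_ ∈ₛ_) A∩B≡⊥ (x∈p∩q⁺ (A'⊆A x∈A' , x∈B))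

  disjoint-⊆ʳ : ∀ {A B B' : Subset n} → B' ⊆ B → A ∩ B ≡ ⊥ → A ∩ B' ≡ ⊥
  disjoint-⊆ʳ {A} {B} {B'} B'⊆B A∩B≡⊥ = ≡.trans (∩-comm A B')
    (disjoint-⊆ˡ B'⊆B (≡.trans (∩-comm B A) A∩B≡⊥))

  disjoint-∪ʳ : ∀ {A B C : Subset n} → A ∩ B ≡ ⊥ → A ∩ C ≡ ⊥ → A ∩ (B ∪ C) ≡ ⊥
  disjoint-∪ʳ {A} {B} {C} A∩B≡⊥ A∩C≡⊥ = begin
    A ∩ (B ∪ C)        ≡⟨ ∩-distribˡ-∪ A B C ⟩
    (A ∩ B) ∪ (A ∩ C)  ≡⟨ cong₂ _∪_ A∩B≡⊥ A∩C≡⊥ ⟩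
    ⊥ ∪ ⊥              ≡⟨ ∪-identityˡ ⊥ ⟩
    ⊥                  ∎
    where open ≡.≡-Reasoning

  Decomp-irrelevant : ∀ {S A B : Subset n} (d d' : Decomp S A B) → d ≡ d'
  Decomp-irrelevant (e₁ , e₂) (e₁' , e₂') = cong₂ _,_ (uip e₁ e₁') (uip e₂ e₂')

  Decomp-⊥ʳ : ∀ (A : Subset n) → Decomp A A ⊥
  Decomp-⊥ʳ A = ∪-identityʳ A , ∩-zeroʳ A

  Decomp-⊥ˡ : ∀ (A : Subset n) → Decomp A ⊥ A
  Decomp-⊥ˡ A = ∪-identityˡ A , ∩-zeroˡ A

  Decomp-assoc : ∀ {I S A B C : Subset n} → Decomp S A B → Decomp I S C →
    Decomp I A (B ∪ C) × Decomp (B ∪ C) B C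
  Decomp-assoc {S = S} {A} {B} {C} (A∪B≡S , A∩B≡⊥) (S∪C≡I , S∩C≡⊥) =
    (≡.trans (sym (∪-assoc A B C)) (≡.trans (cong (_∪ C) A∪B≡S) S∪C≡I) ,
     disjoint-∪ʳ A∩B≡⊥ (disjoint-⊆ˡ A⊆S S∩C≡⊥)) ,
    (≡.refl , disjoint-⊆ˡ B⊆S S∩C≡⊥)
    where
    A⊆S : A ⊆ S
    A⊆S = subst (A ⊆_) A∪B≡S (p⊆p∪q B)
    B⊆S : B ⊆ S
    B⊆S = subst (B ⊆_) A∪B≡S (q⊆p∪q A B)

  Decomp-swap : ∀ {I A B C : Subset n} → Decomp I A (B ∪ C) → B ∩ C ≡ ⊥ →
    Decomp I B (A ∪ C) × A ∩ C ≡ ⊥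
  Decomp-swap {I} {A} {B} {C} (A∪B∪C≡I , A∩B∪C≡⊥) B∩C≡⊥ =
    (≡.trans B∪A∪C≡A∪B∪C A∪B∪C≡I ,
     disjoint-∪ʳ (≡.trans (∩-comm B A) (disjoint-⊆ʳ (p⊆p∪q C) A∩B∪C≡⊥)) B∩C≡⊥) ,
    disjoint-⊆ʳ (q⊆p∪q B C) A∩B∪C≡⊥
    where
    open ≡.≡-Reasoning
    B∪A∪C≡A∪B∪C : B ∪ (A ∪ C) ≡ A ∪ (B ∪ C)
    B∪A∪C≡A∪B∪C = begin
      B ∪ (A ∪ C)  ≡⟨ ∪-assoc B A C ⟨
      (B ∪ A) ∪ C  ≡⟨ cong (_∪ C) (∪-comm B A) ⟩
      (A ∪ B) ∪ C  ≡⟨ ∪-assoc A B C ⟩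
      A ∪ (B ∪ C)  ∎

  ⋃-++ : ∀ (P Q : List (Subset n)) → ⋃ (P ++ Q) ≡ ⋃ P ∪ ⋃ Q
  ⋃-++ []      Q = sym (∪-identityˡ (⋃ Q))
  ⋃-++ (A ∷ P) Q = ≡.trans (cong (A ∪_) (⋃-++ P Q)) (sym (∪-assoc A (⋃ P) (⋃ Q)))

  Comp-⋃ : ∀ {S : Subset n} {L} → Comp S L → ⋃ L ≡ S
  Comp-⋃ nil          = ≡.refl
  Comp-⋃ (cons _ d _) = proj₁ d

  Comp-cons : ∀ {I A U : Subset n} {L} → Nonempty A → Decomp I A U → Comp U L → Comp I (A ∷ L)
  Comp-cons {I} {A} {L = L} A≢∅ d c =
    cons A≢∅ (subst (Decomp I A) (sym (Comp-⋃ c)) d) (subst (λ U → Comp U L) (sym (Comp-⋃ c)) c)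

  Comp-↭ : ∀ {I : Subset n} {L L'} → Comp I L → L ↭ L' → Comp I L'
  Comp-↭ c refl = c
  Comp-↭ (cons A≢∅ d c) (prep _ L↭L') = Comp-cons A≢∅ d (Comp-↭ c L↭L')
  Comp-↭ (cons A≢∅ d (cons B≢∅ d' c)) (swap _ _ L↭L') with Decomp-swap d (proj₂ d')
  ... | dB , A∩⋃L≡⊥ = Comp-cons B≢∅ dB (Comp-cons A≢∅ (≡.refl , A∩⋃L≡⊥) (Comp-↭ c L↭L'))
  Comp-↭ c (trans L↭M M↭L') = Comp-↭ (Comp-↭ c L↭M) M↭L'

  Comp-++ : ∀ {I S U : Subset n} {G L} → Decomp I S U → Comp S G → Comp U L → Comp I (G ++ L)
  Comp-++ {L = L} (S∪U≡I , _) nil c = subst (λ U → Comp U L) (≡.trans (sym (∪-identityˡ _)) S∪U≡I) c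
  Comp-++ d (cons A≢∅ dG cG) c with Decomp-assoc dG d
  ... | dA , dRest = Comp-cons A≢∅ dA (Comp-++ dRest cG c)

  Comp-++⁻ : ∀ {I : Subset n} P {Q} → Comp I (P ++ Q) → Comp (⋃ P) P × Comp (⋃ Q) Q
  Comp-++⁻ []      {Q} c = nil , subst (λ U → Comp U Q) (sym (Comp-⋃ c)) c
  Comp-++⁻ (A ∷ P) {Q} (cons A≢∅ (_ , A∩⋃P++Q≡⊥) c) with Comp-++⁻ P c
  ... | cP , cQ = cons A≢∅ (≡.refl , A∩⋃P≡⊥) cP , cQ
    where
    A∩⋃P≡⊥ : A ∩ ⋃ P ≡ ⊥
    A∩⋃P≡⊥ = disjoint-⊆ʳ (p⊆p∪q (⋃ Q)) (subst (λ U → A ∩ U ≡ ⊥) (⋃-++ P Q) A∩⋃P++Q≡⊥)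

  Decomp-++ : ∀ {I S U : Subset n} {A} G {L} → Decomp S A (⋃ G) → Decomp I S U → Comp U L →
    Decomp (⋃ (G ++ L)) (⋃ G) U
  Decomp-++ {U = U} G {L} dG d cL =
    subst (λ V → Decomp V (⋃ G) U) ⋃G∪U≡⋃G++L (proj₂ (Decomp-assoc dG d))
    where
    ⋃G∪U≡⋃G++L : ⋃ G ∪ U ≡ ⋃ (G ++ L)
    ⋃G∪U≡⋃G++L = ≡.trans (cong (⋃ G ∪_) (sym (Comp-⋃ cL))) (sym (⋃-++ G L))

  Comp-replaceAt : ∀ {I S : Subset n} {L G} → Comp I L → (p : S ∈ L) → Comp S G →
    Comp I (replaceAt p G)
  Comp-replaceAt (cons _ d c)     (here ≡.refl) cG = Comp-++ d cG c
  Comp-replaceAt (cons A≢∅ d c) (there p)     cG = Comp-cons A≢∅ d (Comp-replaceAt c p cG)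

  ≼-refl : ∀ (B : List (Subset n)) → B ≼ B
  ≼-refl []      = []
  ≼-refl (S ∷ B) = step (S ∷ []) B (∪-identityʳ S) (≼-refl B)

  ≼-prepend : ∀ (P : List (Subset n)) {A B} → A ≼ B → (P ++ A) ≼ (P ++ B)
  ≼-prepend []      A≼B = A≼B
  ≼-prepend (S ∷ P) A≼B = step (S ∷ []) _ (∪-identityʳ S) (≼-prepend P A≼B)

  replaceAt-≼ : ∀ {S : Subset n} {B G} (p : S ∈ B) → ⋃ G ≡ S → replaceAt p G ≼ B
  replaceAt-≼ {G = G} (here ≡.refl) ⋃G≡S = step G _ ⋃G≡S (≼-refl _)
  replaceAt-≼ (there {x = S} p) ⋃G≡S = step (S ∷ []) _ (∪-identityʳ S) (replaceAt-≼ p ⋃G≡S)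

  block : ∀ {A B} {S : Subset n} → A ≼ B → S ∈ B → List (Subset n)
  block (step P _ _ _) (here _)  = P
  block (step _ _ _ π) (there p) = block π p

  ⋃-block : ∀ {A B} {S : Subset n} (π : A ≼ B) (p : S ∈ B) → ⋃ (block π p) ≡ S
  ⋃-block (step _ _ ⋃P≡S _) (here ≡.refl) = ⋃P≡S
  ⋃-block (step _ _ _ π)    (there p)     = ⋃-block π p

  ≼-replaceAt-block : ∀ {A B} {S : Subset n} (π : A ≼ B) (p : S ∈ B) → A ≼ replaceAt p (block π p)
  ≼-replaceAt-block (step P _ _ π)    (here ≡.refl) = ≼-prepend P π
  ≼-replaceAt-block (step P Q ⋃P≡S π) (there p)     = step P Q ⋃P≡S (≼-replaceAt-block π p)

  Comp-block : ∀ {I S : Subset n} {A B} → Comp I A → (π : A ≼ B) (p : S ∈ B) → Comp S (block π p)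
  Comp-block c (step P _ ⋃P≡S _) (here ≡.refl) = subst (λ U → Comp U P) ⋃P≡S (proj₁ (Comp-++⁻ P c))
  Comp-block c (step P _ _ π)    (there p)     = Comp-block (proj₂ (Comp-++⁻ P c)) π p

  data BlockShape {A B : List (Subset n)} (π : A ≼ B) : Set where
    all-blocks-singletons : A ≡ B → BlockShape π
    one-coarse-block : ∀ {S} (p : S ∈ B) → 2 ≤ length (block π p) → ∀ pre post →
      A ≡ pre ++ block π p ++ post → B ≡ pre ++ ⋃ (block π p) ∷ post → BlockShape π
    two-coarse-blocks : ∀ {S T} (p : S ∈ B) (q : T ∈ B) → p ≢∈ q →
      2 ≤ length (block π p) → 2 ≤ length (block π q) → BlockShape π

  blockShape : ∀ {I : Subset n} {A B} → Comp I B → (π : A ≼ B) → BlockShape π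
  blockShape nil [] = all-blocks-singletons ≡.refl
  blockShape (cons (x , x∈S) _ _) (step [] _ ⊥≡S _) = ⊥-elim (∉⊥ (subst (x ∈ₛ_) (sym ⊥≡S) x∈S))
  blockShape (cons _ _ c) (step (A ∷ []) Q A∪⊥≡S π)
    with blockShape c π | ≡.trans (sym (∪-identityʳ A)) A∪⊥≡S
  ... | all-blocks-singletons Q≡B | A≡S = all-blocks-singletons (cong₂ _∷_ A≡S Q≡B)
  ... | one-coarse-block p coarse pre post Q≡ B≡ | A≡S =
    one-coarse-block (there p) coarse (A ∷ pre) post (cong (A ∷_) Q≡) (cong₂ _∷_ (sym A≡S) B≡)
  ... | two-coarse-blocks p q p≢q coarse-p coarse-q | _ =
    two-coarse-blocks (there p) (there q) (there-≢∈ p≢q) coarse-p coarse-q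
  blockShape (cons _ _ c) (step (_ ∷ _ ∷ _) _ ⋃P≡S π) with blockShape c π
  ... | all-blocks-singletons Q≡B =
    one-coarse-block (here ≡.refl) (s≤s (s≤s z≤n)) [] _ ≡.refl (cong₂ _∷_ (sym ⋃P≡S) (sym Q≡B))
  ... | one-coarse-block p coarse _ _ _ _ =
    two-coarse-blocks (here ≡.refl) (there p) (λ { ≡.refl () }) (s≤s (s≤s z≤n)) coarse
  ... | two-coarse-blocks p q p≢q coarse-p coarse-q =
    two-coarse-blocks (there p) (there q) (there-≢∈ p≢q) coarse-p coarse-q

module HopfMonoid {n : ℕ} (H : LinHopf n) where
  open LinHopf H

  Δs-irrelevant : ∀ {I L} (c c' : Comp I L) x → Δs H c x ≡ Δs H c' x
  Δs-irrelevant nil nil x = ≡.refl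
  Δs-irrelevant (cons _ d c) (cons _ d' c') x rewrite Decomp-irrelevant d d' with Δ d' x
  ... | nothing      = ≡.refl
  ... | just (a , r) = cong (Maybe.map (a ∷_)) (Δs-irrelevant c c' r)

  μs-irrelevant : ∀ {I L} (c c' : Comp I L) v → μs H c v ≡ μs H c' v
  μs-irrelevant nil nil [] = ≡.refl
  μs-irrelevant (cons _ d c) (cons _ d' c') (a ∷ v) rewrite Decomp-irrelevant d d' =
    cong (μ d' a) (μs-irrelevant c c' v)

  Δs-cons : ∀ {I A L} (A≢∅ : Nonempty A) (d : Decomp I A (⋃ L)) (c : Comp (⋃ L) L) {x a r v} →
    Δ d x ≡ just (a , r) → Δs H c r ≡ just v → Δs H (cons A≢∅ d c) x ≡ just (a ∷ v)
  Δs-cons _ d c Δdx≡ Δscr≡ rewrite Δdx≡ | Δscr≡ = ≡.refl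

  Δ-μ : ∀ {S A B} (d : Decomp S A B) a b → Δ d (μ d a b) ≡ just (a , b)
  Δ-μ {A = A} {B} d a b
    rewrite compat d d (Decomp-⊥ʳ A) (Decomp-⊥ˡ B) (Decomp-⊥ʳ A) (Decomp-⊥ˡ B) a b
          | counitʳ (Decomp-⊥ʳ A) a | counitˡ (Decomp-⊥ˡ B) b
          | unitʳ (Decomp-⊥ʳ A) a | unitˡ (Decomp-⊥ˡ B) b = ≡.refl

  Δs-μs : ∀ {I L} (c : Comp I L) v → Δs H c (μs H c v) ≡ just v
  Δs-μs nil          []      = ≡.refl
  Δs-μs (cons _ d c) (a ∷ v) rewrite Δ-μ d a (μs H c v) | Δs-μs c v = ≡.refl

  coassoc-just : ∀ {S A B C D E} (d₁ : Decomp D A B) (d₂ : Decomp S D C)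
    (e₁ : Decomp E B C) (e₂ : Decomp S A E) x {a v b c} →
    Δ e₂ x ≡ just (a , v) → Δ e₁ v ≡ just (b , c) →
    ∃[ u ] Δ d₂ x ≡ just (u , c) × Δ d₁ u ≡ just (a , b)
  coassoc-just d₁ d₂ e₁ e₂ x Δe₂x≡ Δe₁v≡ with coassoc d₁ d₂ e₁ e₂ x
  ... | eq rewrite Δe₂x≡ | Δe₁v≡ with >>=-just⁻ (Δ d₂ x) _ eq
  ... | (u , _) , Δd₂x≡ , eq' with map-just⁻ _ (Δ d₁ u) eq'
  ... | _ , Δd₁u≡ , ≡.refl = u , Δd₂x≡ , Δd₁u≡

  Δs-++⁻ : ∀ {I S U G L} (d : Decomp I S U) (cG : Comp S G) (cL : Comp U L)
    (c : Comp I (G ++ L)) x {z} → Δs H c x ≡ just z →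
    Σ[ s ∈ h S ] Σ[ r ∈ h U ] Σ[ w ∈ All h G ] Σ[ v ∈ All h L ]
      Δ d x ≡ just (s , r) × Δs H cG s ≡ just w × Δs H cL r ≡ just v × z ≡ ++⁺ w v
  Δs-++⁻ {U = U} d@(⊥∪U≡I , _) nil cL c x {z} Δscx≡ with ≡.trans (sym (∪-identityˡ U)) ⊥∪U≡I
  ... | ≡.refl =
    unit , x , [] , z , counitˡ d x , ≡.refl , ≡.trans (Δs-irrelevant cL c x) Δscx≡ , ≡.refl
  Δs-++⁻ d (cons {L = G} A≢∅ dG cG) cL (cons _ d' c) x Δscx≡
    with >>=-just⁻ (Δ d' x) _ Δscx≡
  ... | (a , r) , Δd'x≡ , eq with map-just⁻ _ (Δs H c r) eq
  ... | _ , Δscr≡ , ≡.refl with Δs-++⁻ (Decomp-++ G dG d cL) cG cL c r Δscr≡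
  ... | _ , r' , w , v , Δr≡ , ΔsGs≡ , ΔsLr'≡ , ≡.refl
    with coassoc-just dG d (Decomp-++ G dG d cL) d' x Δd'x≡ Δr≡
  ... | u , Δdx≡ , ΔdGu≡ =
    u , r' , a ∷ w , v , Δdx≡ , Δs-cons A≢∅ dG cG ΔdGu≡ ΔsGs≡ , ΔsLr'≡ , ≡.refl

  μs-++ : ∀ {I S U G L} (d : Decomp I S U) (cG : Comp S G) (cL : Comp U L)
    (c : Comp I (G ++ L)) w v → μs H c (++⁺ w v) ≡ μ d (μs H cG w) (μs H cL v)
  μs-++ {U = U} d@(⊥∪U≡I , _) nil cL c [] v with ≡.trans (sym (∪-identityˡ U)) ⊥∪U≡I
  ... | ≡.refl = ≡.trans (μs-irrelevant c cL v) (sym (unitˡ d (μs H cL v)))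
  μs-++ d (cons {L = G} _ dG cG) cL (cons _ d' c) (a ∷ w) v =
    ≡.trans (cong (μ d' a) (μs-++ (Decomp-++ G dG d cL) cG cL c w v))
      (sym (assoc dG d (Decomp-++ G dG d cL) d' a (μs H cG w) (μs H cL v)))

  Δ-cast : ∀ {I A U U'} (e : U' ≡ U) (d : Decomp I A U) (d' : Decomp I A U') x {a r} →
    Δ d' x ≡ just (a , r) → Δ d x ≡ just (a , subst h e r)
  Δ-cast ≡.refl d d' x Δd'x≡ rewrite Decomp-irrelevant d d' = Δd'x≡

  μ-cast : ∀ {I A U U'} (e : U' ≡ U) (d : Decomp I A U) (d' : Decomp I A U') b r →
    μ d b (subst h e r) ≡ μ d' b r
  μ-cast ≡.refl d d' b r rewrite Decomp-irrelevant d d' = ≡.refl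

  -- I' is kept apart from I because the tails of the two compositions are indexed by
  -- unions of different lists, which are only propositionally equal.
  Δs-replaceAt⁻ : ∀ {I I' S L G} (e : I' ≡ I) (c : Comp I L) (p : S ∈ L) (cG : Comp S G)
    (c' : Comp I' (replaceAt p G)) x {z} → Δs H c' x ≡ just z →
    Σ[ v ∈ All h L ] Σ[ w ∈ All h G ]
      Δs H c (subst h e x) ≡ just v × z ≡ replaceAt⁺ p v w
  Δs-replaceAt⁻ ≡.refl (cons A≢∅ d c) (here ≡.refl) cG c' x Δsc'x≡
    with Δs-++⁻ d cG c c' x Δsc'x≡
  ... | s , _ , w , v , Δdx≡ , _ , Δscr≡ , ≡.refl = s ∷ v , w , Δs-cons A≢∅ d c Δdx≡ Δscr≡ , ≡.refl
  Δs-replaceAt⁻ ≡.refl (cons A≢∅ d c) (there p) cG (cons _ d' c') x Δsc'x≡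
    with >>=-just⁻ (Δ d' x) _ Δsc'x≡
  ... | (a , r) , Δd'x≡ , eq with map-just⁻ _ (Δs H c' r) eq
  ... | _ , Δsc'r≡ , ≡.refl with Δs-replaceAt⁻ (Comp-⋃ (Comp-replaceAt c p cG)) c p cG c' r Δsc'r≡
  ... | v , w , Δscr≡ , ≡.refl =
    a ∷ v , w , Δs-cons A≢∅ d c (Δ-cast (Comp-⋃ (Comp-replaceAt c p cG)) d d' x Δd'x≡) Δscr≡ ,
    ≡.refl

  μs-replaceAt : ∀ {I I' S L G} (e : I' ≡ I) (c : Comp I L) (p : S ∈ L) (cG : Comp S G)
    (c' : Comp I' (replaceAt p G)) v w →
    subst h e (μs H c' (replaceAt⁺ p v w)) ≡ μs H c (v [ p ]≔ μs H cG w)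
  μs-replaceAt ≡.refl (cons _ d c) (here ≡.refl) cG c' (_ ∷ v) w = μs-++ d cG c c' w v
  μs-replaceAt {G = G} ≡.refl (cons {L = L} _ d c) (there p) cG (cons _ d' c') (a ∷ v) w = begin
    μ d' a (μs H c' (replaceAt⁺ p v w))             ≡⟨ μ-cast e d d' a _ ⟨
    μ d a (subst h e (μs H c' (replaceAt⁺ p v w)))  ≡⟨ cong (μ d a) (μs-replaceAt e c p cG c' v w) ⟩
    μ d a (μs H c (v [ p ]≔ μs H cG w))             ∎
    where
    open ≡.≡-Reasoning
    e : ⋃ (replaceAt p G) ≡ ⋃ L
    e = Comp-⋃ (Comp-replaceAt c p cG)

  InC-replaceAt⁻ : ∀ {I S L G} {x y : h I} (c : Comp I L) (p : S ∈ L) (cG : Comp S G) →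
    InC H x y (replaceAt p G) →
    Σ[ v ∈ All h L ] Σ[ w ∈ All h G ] Δs H c x ≡ just v × μs H c (v [ p ]≔ μs H cG w) ≡ y
  InC-replaceAt⁻ {x = x} c p cG (c' , z , Δsc'x≡ , μsc'z≡y)
    with Δs-replaceAt⁻ ≡.refl c p cG c' x Δsc'x≡
  ... | v , w , Δscx≡ , ≡.refl =
    v , w , Δscx≡ , ≡.trans (sym (μs-replaceAt ≡.refl c p cG c' v w)) μsc'z≡y

  -- Both refinements describe y as μ_L of Δ_L(x) with one factor changed; as Δ_L ∘ μ_L is
  -- the identity, the two changed tuples coincide, so the change at p is no change at all.
  InC-of-two-refinements : ∀ {I S T L G K} {x y : h I} (c : Comp I L) (p : S ∈ L) (q : T ∈ L) →
    p ≢∈ q → Comp S G → Comp T K →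
    InC H x y (replaceAt p G) → InC H x y (replaceAt q K) → InC H x y L
  InC-of-two-refinements {S = S} {T} c p q p≢q cG cK inC-p inC-q
    with InC-replaceAt⁻ c p cG inC-p | InC-replaceAt⁻ c q cK inC-q
  ... | v , w , Δscx≡v , y-p | v' , w' , Δscx≡v' , y-q
    with just-injective (≡.trans (sym Δscx≡v) Δscx≡v')
  ... | ≡.refl = c , v , Δscx≡v , ≡.trans (cong (μs H c) (sym v[p]≔a≡v)) y-p
    where
    open ≡.≡-Reasoning
    a : h S
    a = μs H cG w
    b : h T
    b = μs H cK w'
    v[p]≔a≡v[q]≔b : v [ p ]≔ a ≡ v [ q ]≔ b
    v[p]≔a≡v[q]≔b = just-injective (begin
      just (v [ p ]≔ a)             ≡⟨ Δs-μs c _ ⟨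
      Δs H c (μs H c (v [ p ]≔ a))  ≡⟨ cong (Δs H c) (≡.trans y-p (sym y-q)) ⟩
      Δs H c (μs H c (v [ q ]≔ b))  ≡⟨ Δs-μs c _ ⟩
      just (v [ q ]≔ b)             ∎)
    v[p]≔a≡v : v [ p ]≔ a ≡ v
    v[p]≔a≡v = updateAt-id-local p v (begin
      a                      ≡⟨ lookup∘updateAt v p {λ _ → a} ⟨
      lookup (v [ p ]≔ a) p  ≡⟨ cong (λ u → lookup u p) v[p]≔a≡v[q]≔b ⟩
      lookup (v [ q ]≔ b) p  ≡⟨ lookup∘updateAt′ p q {λ _ → b} {a} v p≢q ⟩
      lookup v p             ∎)

module _ {n : ℕ} where

  merge-one-block : ∀ {Λ A B : List (Subset n)} pre G post → A ↭ Λ →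
    A ≡ pre ++ G ++ post → B ≡ pre ++ ⋃ G ∷ post →
    ∃₂ λ (P R : List (Subset n)) → ((P ++ R) ↭ Λ) × (B ↭ (⋃ P ∷ R))
  merge-one-block pre G post A↭Λ ≡.refl ≡.refl =
    G , pre ++ post , ↭-trans (shifts G pre) A↭Λ , shift (⋃ G) pre post

  merge-one-part : ∀ {Λ B : List (Subset n)} → B ↭ Λ → B ≢ [] →
    ∃₂ λ (P R : List (Subset n)) → ((P ++ R) ↭ Λ) × (B ↭ (⋃ P ∷ R))
  merge-one-part {B = []}     _   B≢[] = ⊥-elim (B≢[] ≡.refl)
  merge-one-part {B = S ∷ B'} B↭Λ _    =
    merge-one-block [] (S ∷ []) B' B↭Λ ≡.refl (cong (_∷ B') (sym (∪-identityʳ S)))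

  coarse-refinement-∈C : ∀ {H : LinHopf n} {I} {x y : LinHopf.h H I} {Λ B σΛ S} →
    Minimal (InUpsetMinusC H x y Λ) B → σΛ ↭ Λ → Comp I σΛ → (π : σΛ ≼ B) (p : S ∈ B) →
    2 ≤ length (block π p) → ¬ ¬ InC H x y (replaceAt p (block π p))
  coarse-refinement-∈C {B = B} ((cB , _) , B-minimal) σΛ↭Λ cσΛ π p coarse ∉C =
    <-irrefl ≡.refl (subst (2 ≤_) (replaceAt-≡⇒length≡1 p refined≡B) coarse)
    where
    refined≡B : replaceAt p (block π p) ≡ B
    refined≡B = B-minimal _
      (Comp-replaceAt cB p (Comp-block cσΛ π p) , (_ , σΛ↭Λ , ≼-replaceAt-block π p) , ∉C)
      (replaceAt-≼ p (⋃-block π p))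

lemma3p5 : ∀ {n : ℕ} (H : LinHopf n) (I : Subset n)
    (x y : LinHopf.h H I) (Λ : List (Subset n)) →
    Minimal (InC H x y) Λ →
    ∀ (B : List (Subset n)) →
    Minimal (InUpsetMinusC H x y Λ) B →
    ∃₂ λ (P R : List (Subset n)) → ((P ++ R) ↭ Λ) × (B ↭ (⋃ P ∷ R))
lemma3p5 H I x y Λ (Λ∈C , _) B B-minimal@((cB , (σΛ , σΛ↭Λ , π) , B∉C) , _) with blockShape cB π
... | all-blocks-singletons ≡.refl = merge-one-part σΛ↭Λ B≢[]
  where
  B≢[] : B ≢ []
  B≢[] ≡.refl = B∉C (subst (InC H x y) (↭-empty-inv (↭-sym σΛ↭Λ)) Λ∈C)
... | one-coarse-block p _ pre post σΛ≡ B≡ = merge-one-block pre (block π p) post σΛ↭Λ σΛ≡ B≡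
... | two-coarse-blocks p q p≢q coarse-p coarse-q =
  ⊥-elim (refined p coarse-p λ inC-p → refined q coarse-q λ inC-q →
    B∉C (InC-of-two-refinements cB p q p≢q (Comp-block cσΛ π p) (Comp-block cσΛ π q) inC-p inC-q))
  where
  open HopfMonoid H using (InC-of-two-refinements)
  cσΛ : Comp I σΛ
  cσΛ = Comp-↭ (proj₁ Λ∈C) (↭-sym σΛ↭Λ)
  refined : ∀ {S} (p : S ∈ B) → 2 ≤ length (block π p) → ¬ ¬ InC H x y (replaceAt p (block π p))
  refined = coarse-refinement-∈C B-minimal σΛ↭Λ cσΛ π
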